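{- Let $\mathbf S$ be $\mathbf{PR}_{\mathrm A}$ or an extension admitting predicate abstraction and let $\varphi=\varphi(a,n)\colon A\times\mathbb N\to\mathbf 2$ be an $\mathbf S$-predicate. Define the partial map $\mu\varphi=\langle(d_{\mu\varphi},\widehat\mu\varphi)\colon D_{\mu\varphi}\to A\times\mathbb N\rangle\colon A\rightharpoonup\mathbb N$ by $D_{\mu\varphi}=\{A\times\mathbb N:\varphi\}$, $d_{\mu\varphi}(a,n)=a$, $\widehat\mu\varphi(a,n)=\min\{m\le n:\varphi(a,m)\}$. Then $\mu\varphi$ is a map of $\widehat{\mathbf S}$ with $\mathbf S\vdash\varphi(d_{\mu\varphi}(\hat a),\widehat\mu\varphi(\hat a))=\mathrm{true}_{D_{\mu\varphi}}$ and $\mathbf S\vdash[\varphi(d_{\mu\varphi}(\hat a),n)\Rightarrow\widehat\mu\varphi(\hat a)\le n]\colon D_{\mu\varphi}\times\mathbb N\to\mathbf 2$; and it is unique in the following sense: if $f\colon A\rightharpoonup\mathbb N$ in $\widehat{\mathbf S}$ satisfies $\mathbf S\vdash\varphi(d_f(\hat a),\widehat f(\hat a))=\mathrm{true}_{D_f}$ and $\mathbf S\vdash[\varphi(d_f(\hat a),n)\Rightarrow\widehat f(\hat a)\le n]\colon D_f\times\mathbb N\to\mathbf 2$, then $\mathbf S\vdash f\,\widehat\subseteq\,\mu\varphi$.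
   Context: $\mathbf{PR}_{\mathrm A}$ is the theory of primitive recursion with predicate abstraction: objects are $\{A:\chi\}$ for $A$ a finite power of $\mathbb N$ (or $\mathbf 1$) and $\chi$ a primitive recursive predicate; maps are primitive recursive maps respecting the predicates, equal when provably equal on the defining predicate; $\mathbf 2=\{n\in\mathbb N:n\le 1\}$ with $0=\mathrm{false}$, $1=\mathrm{true}$. $\widehat{\mathbf S}$ is the theory of partial $\mathbf S$-maps: a partial map $f\colon A\rightharpoonup B$ is a pair of $\mathbf S$-maps $d_f\colon D_f\to A$, $\widehat f\colon D_f\to B$ with $d_f(\hat a)\doteq d_f(\hat a')\Rightarrow\widehat f(\hat a)\doteq\widehat f(\hat a')$; $f'\widehat\subseteq f$ means there is an $\mathbf S$-map $i\colon D_{f'}\to D_f$ with $d_f i=d_{f'}$, $\widehat f i=\widehat{f'}$. -}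

module Defs where

open import Data.Nat using (ℕ; zero; suc; _+_)
open import Data.Fin using (Fin; zero; suc; _↑ˡ_; _↑ʳ_)
open import Data.Vec.Functional using ([]; _∷_)
open import Data.Product using (Σ; _×_)
open import Function using (_∘_)

-- Syntax of primitive recursive maps ℕ^k → ℕ, over a signature of
-- extra function symbols (Sym k = extra symbols of arity k).

data Fn (Sym : ℕ → Set) : ℕ → Set where
  Z : Fn Sym 0
  S : Fn Sym 1
  P : ∀ {k} → Fin k → Fn Sym k
  C : ∀ {k m} → Fn Sym m → (Fin m → Fn Sym k) → Fn Sym k
  -- primitive recursion on the first argument:
  --   R g h (0 , x) = g x ;  R g h (n+1 , x) = h (n , R g h (n , x) , x)
  R : ∀ {k} → Fn Sym k → Fn Sym (suc (suc k)) → Fn Sym (suc k)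
  X : ∀ {k} → Sym k → Fn Sym k

data Tm (Sym : ℕ → Set) (n : ℕ) : Set where
  var : Fin n → Tm Sym n
  app : ∀ {k} → Fn Sym k → (Fin k → Tm Sym n) → Tm Sym n

module _ {Sym : ℕ → Set} where

  _[_] : ∀ {n m} → Tm Sym n → (Fin n → Tm Sym m) → Tm Sym m
  var i    [ σ ] = σ i
  app f ts [ σ ] = app f (λ i → ts i [ σ ])

  lam : ∀ {n} → Tm Sym n → Fn Sym n
  lam (var i)    = P i
  lam (app f ts) = C f (λ i → lam (ts i))

  z : ∀ {n} → Tm Sym n
  z = app Z []

  s : ∀ {n} → Tm Sym n → Tm Sym n
  s t = app S (t ∷ [])

  one : ∀ {n} → Tm Sym n
  one = s z

  predF : Fn Sym 1
  predF = R Z (P zero)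

  subF : Fn Sym 2          -- subF (n , m) = m ∸ n
  subF = R (P zero) (C predF (λ _ → P (suc zero)))

  addF : Fn Sym 2          -- addF (n , m) = m + n
  addF = R (P zero) (C S (λ _ → P (suc zero)))

  condF : Fn Sym 3         -- condF (c , x , y) = if c ≠ 0 then x else y
  condF = R (P (suc zero)) (P (suc (suc zero)))

  _∸'_ : ∀ {n} → Tm Sym n → Tm Sym n → Tm Sym n
  t ∸' u = app subF (u ∷ t ∷ [])

  _+'_ : ∀ {n} → Tm Sym n → Tm Sym n → Tm Sym n
  t +' u = app addF (u ∷ t ∷ [])

  -- truth-valued operations (0 = false, 1 = true)
  le : ∀ {n} → Tm Sym n → Tm Sym n → Tm Sym n
  le t u = one ∸' (t ∸' u)

  eq : ∀ {n} → Tm Sym n → Tm Sym n → Tm Sym n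
  eq t u = one ∸' ((t ∸' u) +' (u ∸' t))

  imp : ∀ {n} → Tm Sym n → Tm Sym n → Tm Sym n
  imp p q = one ∸' (p ∸' q)

  and : ∀ {n} → Tm Sym n → Tm Sym n → Tm Sym n
  and p q = one ∸' ((one ∸' p) +' (one ∸' q))

  eqv : ∀ {k n} → (Fin k → Tm Sym n) → (Fin k → Tm Sym n) → Tm Sym n
  eqv {zero}  σ τ = one
  eqv {suc k} σ τ = and (eq (σ zero) (τ zero)) (eqv (σ ∘ suc) (τ ∘ suc))

  wk : ∀ {n} → Tm Sym n → Tm Sym (suc n)
  wk t = t [ var ∘ suc ]

  inL : ∀ {j} → Tm Sym j → Tm Sym (j + j)
  inL {j} t = t [ (λ i → var (i ↑ˡ j)) ]

  inR : ∀ {j} → Tm Sym j → Tm Sym (j + j)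
  inR {j} t = t [ (λ i → var (j ↑ʳ i)) ]

-- Theories: PR (Goodstein-style equational primitive recursive
-- arithmetic) over extra symbols Sym with extra equational axioms Ax.
-- Sym = ⊥-family and Ax = ⊥ gives PR itself.

record Theory : Set₁ where
  field
    Sym : ℕ → Set
    Ax  : ∀ {n} → Tm Sym n → Tm Sym n → Set
open Theory public

infix 3 _⊢_≈_
data _⊢_≈_ (T : Theory) : ∀ {n} → Tm (Sym T) n → Tm (Sym T) n → Set where
  ax     : ∀ {n} {t u : Tm (Sym T) n} → Ax T t u → T ⊢ t ≈ u
  ≈refl  : ∀ {n} {t : Tm (Sym T) n} → T ⊢ t ≈ t
  ≈sym   : ∀ {n} {t u : Tm (Sym T) n} → T ⊢ t ≈ u → T ⊢ u ≈ t
  ≈trans : ∀ {n} {t u v : Tm (Sym T) n} → T ⊢ t ≈ u → T ⊢ u ≈ v → T ⊢ t ≈ v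
  ≈cong  : ∀ {n k} (f : Fn (Sym T) k) {ts us : Fin k → Tm (Sym T) n} →
           (∀ i → T ⊢ ts i ≈ us i) → T ⊢ app f ts ≈ app f us
  ≈subst : ∀ {n m} {t u : Tm (Sym T) n} (σ : Fin n → Tm (Sym T) m) →
           T ⊢ t ≈ u → T ⊢ t [ σ ] ≈ u [ σ ]
  proj   : ∀ {n k} (i : Fin k) {ts : Fin k → Tm (Sym T) n} →
           T ⊢ app (P i) ts ≈ ts i
  comp   : ∀ {n k m} (f : Fn (Sym T) m) (gs : Fin m → Fn (Sym T) k)
           {ts : Fin k → Tm (Sym T) n} →
           T ⊢ app (C f gs) ts ≈ app f (λ i → app (gs i) ts)
  rec0   : ∀ {n k} (g : Fn (Sym T) k) (h : Fn (Sym T) (suc (suc k)))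
           {ts : Fin k → Tm (Sym T) n} →
           T ⊢ app (R g h) (z ∷ ts) ≈ app g ts
  recS   : ∀ {n k} (g : Fn (Sym T) k) (h : Fn (Sym T) (suc (suc k)))
           {x : Tm (Sym T) n} {ts : Fin k → Tm (Sym T) n} →
           T ⊢ app (R g h) (s x ∷ ts)
             ≈ app h (x ∷ app (R g h) (x ∷ ts) ∷ ts)
  -- Goodstein's uniqueness (induction) rule; variable 0 is the
  -- induction variable
  induct : ∀ {n} (F G : Tm (Sym T) (suc n)) (H : Tm (Sym T) (suc (suc n))) →
           T ⊢ F [ z ∷ var ] ≈ G [ z ∷ var ] →
           T ⊢ F [ s (var zero) ∷ (var ∘ suc) ]
             ≈ H [ var zero ∷ F ∷ (var ∘ suc) ] →
           T ⊢ G [ s (var zero) ∷ (var ∘ suc) ]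
             ≈ H [ var zero ∷ G ∷ (var ∘ suc) ] →
           T ⊢ F ≈ G

module _ (T : Theory) where

  private
    Tm' = Tm (Sym T)

  -- provable equality on the predicate χ (maps out of {ℕ^n : χ})
  _⊢[_]_≈_ : ∀ {n} → Tm' n → Tm' n → Tm' n → Set
  _⊢[_]_≈_ χ t u = T ⊢ imp χ (eq t u) ≈ one

  -- t : ℕ^n → 𝟐 is an S-predicate (a map into 𝟐 = {n : n ≤ 1})
  IsPred : ∀ {n} → Tm' n → Set
  IsPred t = T ⊢ le t one ≈ one

-- Partial maps ℕ^k ⇀ ℕ:  d : D → ℕ^k ,  f̂ : D → ℕ  with D = {ℕ^j : δ}

record RawPMap (Sym : ℕ → Set) (k : ℕ) : Set where
  field
    dim  : ℕ
    δ    : Tm Sym dim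
    d    : Fin k → Tm Sym dim
    fhat : Tm Sym dim
open RawPMap public

module _ (T : Theory) {k : ℕ} where

  -- f is a map of Ŝ: D is an object and d(â) ≐ d(â') ⇒ f̂(â) ≐ f̂(â')
  -- holds on D × D
  IsPMap : RawPMap (Sym T) k → Set
  IsPMap f =
    IsPred T (δ f) ×
    (T ⊢[ and (inL (δ f)) (inR (δ f)) ]
        imp (eqv (inL ∘ d f) (inR ∘ d f)) (eq (inL (fhat f)) (inR (fhat f)))
        ≈ one)

  -- f' ⊆̂ f : an S-map i : D_f' → D_f with d_f i = d_f' and f̂ i = f̂'
  _⊆̂_ : RawPMap (Sym T) k → RawPMap (Sym T) k → Set
  f' ⊆̂ f =
    Σ (Fin (dim f) → Tm (Sym T) (dim f')) λ i →
      (T ⊢[ δ f' ] δ f [ i ] ≈ one) ×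
      (∀ x → T ⊢[ δ f' ] d f x [ i ] ≈ d f' x) ×
      (T ⊢[ δ f' ] fhat f [ i ] ≈ fhat f')

  -- A × ℕ is coded as ℕ^(suc k) with the ℕ-coordinate at index 0.
  -- The two properties of a least witness for φ:
  --   φ(d_f(â), f̂(â)) = true on D_f, and
  --   [φ(d_f(â), n) ⇒ f̂(â) ≤ n] = true on D_f × ℕ (n = variable 0).
  MinSpec : Tm (Sym T) (suc k) → RawPMap (Sym T) k → Set
  MinSpec φ f =
    (T ⊢[ δ f ] φ [ fhat f ∷ d f ] ≈ one) ×
    (T ⊢[ wk (δ f) ]
        imp (φ [ var zero ∷ (wk ∘ d f) ]) (le (wk (fhat f)) (var zero))
        ≈ one)

module _ {Sym : ℕ → Set} {k : ℕ} where

  -- bminF φ (n , a) = min { m ≤ n : φ(a, m) }  (and n if there is none):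
  --   bmin(0 , a) = 0
  --   bmin(n+1 , a) = if φ(a, bmin(n,a)) then bmin(n,a) else n+1
  bminF : Tm Sym (suc k) → Fn Sym (suc k)
  bminF φ =
    R (C Z [])
      (lam (app condF
         (φ [ var (suc zero) ∷ (λ i → var (suc (suc i))) ]
          ∷ var (suc zero)
          ∷ s (var zero)
          ∷ [])))

  μ : Tm Sym (suc k) → RawPMap Sym k
  μ φ = record
    { dim  = suc k
    ; δ    = φ
    ; d    = var ∘ suc
    ; fhat = app (bminF φ) var
    }

-- All reasoning takes place inside Goodstein's equational calculus T ⊢ t ≈ u
-- of Defs, whose only non-equational rule is the uniqueness rule `induct`.  The theorem follows: uniqueness gives that μφ is
-- single-valued, witness and minimality are the least-witness
-- specification, and any f meeting that specification satisfies
-- bmin(f̂, d_f) = f̂ on D_f, so â ↦ (f̂(â), d_f(â)) includes f in μφ.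

module Submission where

open import Defs
open import Data.Nat using (ℕ; zero; suc; _+_)
open import Data.Fin using (Fin; zero; suc; _↑ˡ_; _↑ʳ_)
open import Data.Vec.Functional using ([]; _∷_)
open import Data.Product using (_×_; _,_)
open import Function using (_∘_)

module Equational (T : Theory) where

  Term : ℕ → Set
  Term = Tm (Sym T)

  infix 3 _≋_
  _≋_ : ∀ {n} → Term n → Term n → Set
  a ≋ b = T ⊢ a ≈ b

  infixr 2 _■_
  _■_ : ∀ {n} {a b c : Term n} → a ≋ b → b ≋ c → a ≋ c
  _■_ = ≈trans

  !_ : ∀ {n} {a b : Term n} → a ≋ b → b ≋ a
  !_ = ≈sym

  subst-cong : ∀ {n m} (t : Term n) {σ τ : Fin n → Term m} →
               (∀ i → σ i ≋ τ i) → t [ σ ] ≋ t [ τ ]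
  subst-cong (var i)    e = e i
  subst-cong (app f ts) e = ≈cong f (λ i → subst-cong (ts i) e)

  subst-subst : ∀ {n m l} (t : Term n) {σ : Fin n → Term m} {τ : Fin m → Term l} →
                t [ σ ] [ τ ] ≋ t [ (λ i → σ i [ τ ]) ]
  subst-subst (var i)    = ≈refl
  subst-subst (app f ts) = ≈cong f (λ i → subst-subst (ts i))

  subst-var : ∀ {n} (t : Term n) → t [ var ] ≋ t
  subst-var (var i)    = ≈refl
  subst-var (app f ts) = ≈cong f (λ i → subst-var (ts i))

  wk-inst : ∀ {n} (t u : Term n) → wk t [ u ∷ var ] ≋ t
  wk-inst t u = subst-subst t ■ subst-var t

  lam-app : ∀ {n m} (t : Term n) (σ : Fin n → Term m) → app (lam t) σ ≋ t [ σ ]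
  lam-app (var i)    σ = proj i
  lam-app (app f ts) σ = comp f _ ■ ≈cong f (λ i → lam-app (ts i) σ)

  pred : ∀ {n} → Term n → Term n
  pred t = app predF (t ∷ [])

  cond : ∀ {n} → Term n → Term n → Term n → Term n
  cond c a b = app condF (c ∷ a ∷ b ∷ [])

  neg : ∀ {n} → Term n → Term n
  neg t = one ∸' t

  sg : ∀ {n} → Term n → Term n
  sg t = neg (neg t)

  pred-z : ∀ {n} → pred {n} z ≋ z
  pred-z = rec0 Z (P zero)

  pred-s : ∀ {n} {x : Term n} → pred (s x) ≋ x
  pred-s = recS Z (P zero) ■ proj zero

  ∸-z : ∀ {n} {a : Term n} → a ∸' z ≋ a
  ∸-z = rec0 (P zero) _ ■ proj zero

  ∸-s : ∀ {n} {a b : Term n} → a ∸' s b ≋ pred (a ∸' b)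
  ∸-s = recS (P zero) _ ■ comp predF _ ■ ≈cong predF (λ { zero → proj (suc zero) })

  +-z : ∀ {n} {a : Term n} → a +' z ≋ a
  +-z = rec0 (P zero) _ ■ proj zero

  +-s : ∀ {n} {a b : Term n} → a +' s b ≋ s (a +' b)
  +-s = recS (P zero) _ ■ comp S _ ■ ≈cong S (λ { zero → proj (suc zero) })

  cond-z : ∀ {n} {a b : Term n} → cond z a b ≋ b
  cond-z = rec0 (P (suc zero)) _ ■ proj (suc zero)

  cond-s : ∀ {n} {c a b : Term n} → cond (s c) a b ≋ a
  cond-s = recS (P (suc zero)) _ ■ proj (suc (suc zero))

  s≋ : ∀ {n} {a b : Term n} → a ≋ b → s a ≋ s b
  s≋ e = ≈cong S (λ { zero → e })

  pred≋ : ∀ {n} {a b : Term n} → a ≋ b → pred a ≋ pred b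
  pred≋ e = ≈cong predF (λ { zero → e })

  ∸≋ : ∀ {n} {a b c d : Term n} → a ≋ b → c ≋ d → a ∸' c ≋ b ∸' d
  ∸≋ e₁ e₂ = ≈cong subF (λ { zero → e₂ ; (suc zero) → e₁ })

  +≋ : ∀ {n} {a b c d : Term n} → a ≋ b → c ≋ d → a +' c ≋ b +' d
  +≋ e₁ e₂ = ≈cong addF (λ { zero → e₂ ; (suc zero) → e₁ })

  cond≋ : ∀ {n} {a b c d e f : Term n} → a ≋ b → c ≋ d → e ≋ f → cond a c e ≋ cond b d f
  cond≋ e₁ e₂ e₃ = ≈cong condF (λ { zero → e₁ ; (suc zero) → e₂ ; (suc (suc zero)) → e₃ })

  neg≋ : ∀ {n} {a b : Term n} → a ≋ b → neg a ≋ neg b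
  neg≋ e = ∸≋ ≈refl e

  sg≋ : ∀ {n} {a b : Term n} → a ≋ b → sg a ≋ sg b
  sg≋ e = neg≋ (neg≋ e)

-- Schemes: terms over metavariables built from the operations above, so
-- that an instance ⟦ e ⟧ ρ is literally the intended term.  The only
-- non-equational rule of T, Goodstein's uniqueness rule, becomes usable as
-- induction (and case analysis) on a metavariable of a scheme.
module Schemes (T : Theory) where

  open Equational T

  infixl 6 _∸ˢ_ _+ˢ_
  infix 30 #_
  data Sch (k : ℕ) : Set where
    #_    : Fin k → Sch k
    zˢ    : Sch k
    sˢ    : Sch k → Sch k
    pˢ    : Sch k → Sch k
    _∸ˢ_  : Sch k → Sch k → Sch k
    _+ˢ_  : Sch k → Sch k → Sch k
    condˢ : Sch k → Sch k → Sch k → Sch k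
    termˢ : ∀ {j} → Term j → (Fin j → Sch k) → Sch k

  ⟦_⟧ : ∀ {k m} → Sch k → (Fin k → Term m) → Term m
  ⟦ # i ⟧         ρ = ρ i
  ⟦ zˢ ⟧          ρ = z
  ⟦ sˢ e ⟧        ρ = s (⟦ e ⟧ ρ)
  ⟦ pˢ e ⟧        ρ = pred (⟦ e ⟧ ρ)
  ⟦ a ∸ˢ b ⟧      ρ = ⟦ a ⟧ ρ ∸' ⟦ b ⟧ ρ
  ⟦ a +ˢ b ⟧      ρ = ⟦ a ⟧ ρ +' ⟦ b ⟧ ρ
  ⟦ condˢ c a b ⟧ ρ = cond (⟦ c ⟧ ρ) (⟦ a ⟧ ρ) (⟦ b ⟧ ρ)
  ⟦ termˢ t as ⟧  ρ = t [ (λ i → ⟦ as i ⟧ ρ) ]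

  #0 : ∀ {k} → Sch (suc k)
  #0 = # zero
  #1 : ∀ {k} → Sch (suc (suc k))
  #1 = # suc zero
  #2 : ∀ {k} → Sch (suc (suc (suc k)))
  #2 = # suc (suc zero)
  #3 : ∀ {k} → Sch (suc (suc (suc (suc k))))
  #3 = # suc (suc (suc zero))

  oneˢ : ∀ {k} → Sch k
  oneˢ = sˢ zˢ
  negˢ : ∀ {k} → Sch k → Sch k
  negˢ e = oneˢ ∸ˢ e
  sgˢ : ∀ {k} → Sch k → Sch k
  sgˢ e = negˢ (negˢ e)

  ⟦⟧-subst : ∀ {k m l} (e : Sch k) (ρ : Fin k → Term m) (σ : Fin m → Term l) →
             ⟦ e ⟧ ρ [ σ ] ≋ ⟦ e ⟧ (λ i → ρ i [ σ ])
  ⟦⟧-subst (# i)         ρ σ = ≈refl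
  ⟦⟧-subst zˢ            ρ σ = ≈cong Z (λ ())
  ⟦⟧-subst (sˢ e)        ρ σ = ≈cong S (λ { zero → ⟦⟧-subst e ρ σ })
  ⟦⟧-subst (pˢ e)        ρ σ = ≈cong predF (λ { zero → ⟦⟧-subst e ρ σ })
  ⟦⟧-subst (a ∸ˢ b)      ρ σ =
    ≈cong subF (λ { zero → ⟦⟧-subst b ρ σ ; (suc zero) → ⟦⟧-subst a ρ σ })
  ⟦⟧-subst (a +ˢ b)      ρ σ =
    ≈cong addF (λ { zero → ⟦⟧-subst b ρ σ ; (suc zero) → ⟦⟧-subst a ρ σ })
  ⟦⟧-subst (condˢ c a b) ρ σ = ≈cong condF (λ { zero → ⟦⟧-subst c ρ σ
    ; (suc zero) → ⟦⟧-subst a ρ σ ; (suc (suc zero)) → ⟦⟧-subst b ρ σ })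
  ⟦⟧-subst (termˢ t as)  ρ σ = subst-subst t ■ subst-cong t (λ i → ⟦⟧-subst (as i) ρ σ)

  ⟦⟧-cong : ∀ {k m} (e : Sch k) {ρ ρ' : Fin k → Term m} →
            (∀ i → ρ i ≋ ρ' i) → ⟦ e ⟧ ρ ≋ ⟦ e ⟧ ρ'
  ⟦⟧-cong (# i)         E = E i
  ⟦⟧-cong zˢ            E = ≈refl
  ⟦⟧-cong (sˢ e)        E = s≋ (⟦⟧-cong e E)
  ⟦⟧-cong (pˢ e)        E = pred≋ (⟦⟧-cong e E)
  ⟦⟧-cong (a ∸ˢ b)      E = ∸≋ (⟦⟧-cong a E) (⟦⟧-cong b E)
  ⟦⟧-cong (a +ˢ b)      E = +≋ (⟦⟧-cong a E) (⟦⟧-cong b E)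
  ⟦⟧-cong (condˢ c a b) E = cond≋ (⟦⟧-cong c E) (⟦⟧-cong a E) (⟦⟧-cong b E)
  ⟦⟧-cong (termˢ t as)  E = subst-cong t (λ i → ⟦⟧-cong (as i) E)

  infixl 25 _⟪_⟫
  _⟪_⟫ : ∀ {k k'} → Sch k → (Fin k → Sch k') → Sch k'
  # i ⟪ τ ⟫         = τ i
  zˢ ⟪ τ ⟫          = zˢ
  sˢ e ⟪ τ ⟫        = sˢ (e ⟪ τ ⟫)
  pˢ e ⟪ τ ⟫        = pˢ (e ⟪ τ ⟫)
  (a ∸ˢ b) ⟪ τ ⟫    = a ⟪ τ ⟫ ∸ˢ b ⟪ τ ⟫
  (a +ˢ b) ⟪ τ ⟫    = a ⟪ τ ⟫ +ˢ b ⟪ τ ⟫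
  condˢ c a b ⟪ τ ⟫ = condˢ (c ⟪ τ ⟫) (a ⟪ τ ⟫) (b ⟪ τ ⟫)
  termˢ t as ⟪ τ ⟫  = termˢ t (λ i → as i ⟪ τ ⟫)

  ⟦⟧-⟪⟫ : ∀ {k k' m} (e : Sch k) (τ : Fin k → Sch k') (ρ : Fin k' → Term m) →
          ⟦ e ⟪ τ ⟫ ⟧ ρ ≋ ⟦ e ⟧ (λ i → ⟦ τ i ⟧ ρ)
  ⟦⟧-⟪⟫ (# i)         τ ρ = ≈refl
  ⟦⟧-⟪⟫ zˢ            τ ρ = ≈refl
  ⟦⟧-⟪⟫ (sˢ e)        τ ρ = s≋ (⟦⟧-⟪⟫ e τ ρ)
  ⟦⟧-⟪⟫ (pˢ e)        τ ρ = pred≋ (⟦⟧-⟪⟫ e τ ρ)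
  ⟦⟧-⟪⟫ (a ∸ˢ b)      τ ρ = ∸≋ (⟦⟧-⟪⟫ a τ ρ) (⟦⟧-⟪⟫ b τ ρ)
  ⟦⟧-⟪⟫ (a +ˢ b)      τ ρ = +≋ (⟦⟧-⟪⟫ a τ ρ) (⟦⟧-⟪⟫ b τ ρ)
  ⟦⟧-⟪⟫ (condˢ c a b) τ ρ = cond≋ (⟦⟧-⟪⟫ c τ ρ) (⟦⟧-⟪⟫ a τ ρ) (⟦⟧-⟪⟫ b τ ρ)
  ⟦⟧-⟪⟫ (termˢ t as)  τ ρ = subst-cong t (λ i → ⟦⟧-⟪⟫ (as i) τ ρ)

  Valid : ∀ {k} → Sch k → Sch k → Set
  Valid {k} e₁ e₂ = ∀ {m} (ρ : Fin k → Term m) → ⟦ e₁ ⟧ ρ ≋ ⟦ e₂ ⟧ ρ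

  at-zero at-suc : ∀ {k} → Fin (suc k) → Sch (suc k)
  at-zero = zˢ ∷ (#_ ∘ suc)
  at-suc  = sˢ #0 ∷ (#_ ∘ suc)

  -- It is
  -- the rule `induct` applied to the generic instance, in which the
  -- induction metavariable is the fresh variable 0.
  induction : ∀ {k} (e₁ e₂ : Sch (suc k)) (H : Sch (suc (suc k))) →
              Valid (e₁ ⟪ at-zero ⟫) (e₂ ⟪ at-zero ⟫) →
              Valid (e₁ ⟪ at-suc ⟫) (H ⟪ e₁ ∷ #_ ⟫) →
              Valid (e₂ ⟪ at-suc ⟫) (H ⟪ e₂ ∷ #_ ⟫) →
              Valid e₁ e₂
  induction {k} e₁ e₂ H base₌ step₁ step₂ {m} ρ =
    ! back e₁
    ■ ≈subst (ρ zero ∷ var)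
        (induct (⟦ e₁ ⟧ ρ') (⟦ e₂ ⟧ ρ') Hᵍ
          (base e₁ ■ base₌ ρ ■ ! base e₂)
          (step e₁ ■ step₁ ρ' ■ recurrence e₁)
          (step e₂ ■ step₂ ρ' ■ recurrence e₂))
    ■ back e₂
    where
      ρ' : Fin (suc k) → Term (suc m)
      ρ' = var zero ∷ (wk ∘ ρ ∘ suc)

      Hᵍ : Term (suc (suc m))
      Hᵍ = ⟦ H ⟧ (var (suc zero) ∷ var zero ∷ (λ i → ρ (suc i) [ (λ j → var (suc (suc j))) ]))

      generic-inst : ∀ {m'} (e : Sch (suc k)) (σ : Fin (suc m) → Term m') →
                     ⟦ e ⟧ ρ' [ σ ] ≋ ⟦ e ⟧ (σ zero ∷ (λ i → ρ (suc i) [ σ ∘ suc ]))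
      generic-inst e σ = ⟦⟧-subst e ρ' σ
        ■ ⟦⟧-cong e (λ { zero → ≈refl ; (suc i) → subst-subst (ρ (suc i)) })

      base : ∀ e → ⟦ e ⟧ ρ' [ z ∷ var ] ≋ ⟦ e ⟪ at-zero ⟫ ⟧ ρ
      base e = generic-inst e (z ∷ var)
        ■ ⟦⟧-cong e (λ { zero → ≈refl ; (suc i) → subst-var (ρ (suc i)) })
        ■ ! ⟦⟧-⟪⟫ e at-zero ρ

      step : ∀ e → ⟦ e ⟧ ρ' [ s (var zero) ∷ (var ∘ suc) ] ≋ ⟦ e ⟪ at-suc ⟫ ⟧ ρ'
      step e = generic-inst e (s (var zero) ∷ (var ∘ suc))
        ■ ⟦⟧-cong e (λ { zero → ≈refl ; (suc i) → ≈refl })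
        ■ ! ⟦⟧-⟪⟫ e at-suc ρ'

      recurrence : ∀ e → ⟦ H ⟪ e ∷ #_ ⟫ ⟧ ρ' ≋ Hᵍ [ var zero ∷ ⟦ e ⟧ ρ' ∷ (var ∘ suc) ]
      recurrence e = ⟦⟧-⟪⟫ H (e ∷ #_) ρ'
        ■ ⟦⟧-cong H (λ { zero → ≈refl ; (suc zero) → ≈refl
                       ; (suc (suc i)) → ! subst-subst (ρ (suc i)) })
        ■ ! ⟦⟧-subst H _ _

      back : ∀ e → ⟦ e ⟧ ρ' [ ρ zero ∷ var ] ≋ ⟦ e ⟧ ρ
      back e = generic-inst e (ρ zero ∷ var)
        ■ ⟦⟧-cong e (λ { zero → ≈refl ; (suc i) → subst-var (ρ (suc i)) })

  -- Case analysis on metavariable 0: the recurrence ignores the previous value.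
  cases : ∀ {k} (e₁ e₂ : Sch (suc k)) →
          Valid (e₁ ⟪ at-zero ⟫) (e₂ ⟪ at-zero ⟫) →
          Valid (e₁ ⟪ at-suc ⟫) (e₂ ⟪ at-suc ⟫) →
          Valid e₁ e₂
  cases e₁ e₂ base₌ step₌ = induction e₁ e₂ H base₌
    (λ ρ → step₌ ρ ■ ! forget e₁ ρ) (λ ρ → ! forget e₂ ρ)
    where
      H = e₂ ⟪ at-suc ⟫ ⟪ #_ ∘ suc ⟫
      forget : ∀ {m} e (ρ : Fin _ → Term m) → ⟦ H ⟪ e ∷ #_ ⟫ ⟧ ρ ≋ ⟦ e₂ ⟪ at-suc ⟫ ⟧ ρ
      forget e ρ = ⟦⟧-⟪⟫ H (e ∷ #_) ρ ■ ⟦⟧-⟪⟫ (e₂ ⟪ at-suc ⟫) (#_ ∘ suc) _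

module Arithmetic (T : Theory) where

  open Equational T
  open Schemes T

  z∸ : ∀ {n} (a : Term n) → z ∸' a ≋ z
  z∸ a = induction (zˢ ∸ˢ #0) zˢ (pˢ #0) (λ _ → ∸-z) (λ _ → ∸-s) (λ _ → ! pred-z) (a ∷ [])

  pred-s∸ : ∀ {n} (y m : Term n) → pred (s y ∸' m) ≋ y ∸' m
  pred-s∸ y m = induction (pˢ (sˢ #1 ∸ˢ #0)) (#1 ∸ˢ #0) (pˢ #0)
    (λ _ → pred≋ ∸-z ■ pred-s ■ ! ∸-z) (λ _ → pred≋ ∸-s) (λ _ → ∸-s) (m ∷ y ∷ [])

  s∸s : ∀ {n} (y m : Term n) → s y ∸' s m ≋ y ∸' m
  s∸s y m = ∸-s ■ pred-s∸ y m

  ∸-self : ∀ {n} (x : Term n) → x ∸' x ≋ z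
  ∸-self x = induction (#0 ∸ˢ #0) zˢ #0 (λ _ → ∸-z) (λ _ → s∸s _ _) (λ _ → ≈refl) (x ∷ [])

  z+ : ∀ {n} (b : Term n) → z +' b ≋ b
  z+ b = induction (zˢ +ˢ #0) #0 (sˢ #0) (λ _ → +-z) (λ _ → +-s) (λ _ → ≈refl) (b ∷ [])

  s+ : ∀ {n} (a b : Term n) → s a +' b ≋ s (a +' b)
  s+ a b = induction (sˢ #1 +ˢ #0) (sˢ (#1 +ˢ #0)) (sˢ #0)
    (λ _ → +-z ■ s≋ (! +-z)) (λ _ → +-s) (λ _ → s≋ +-s) (b ∷ a ∷ [])

  +∸ : ∀ {n} (a b : Term n) → (a +' b) ∸' a ≋ b
  +∸ a b = induction ((#0 +ˢ #1) ∸ˢ #0) #1 #0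
    (λ _ → ∸-z ■ z+ _) (λ _ → ∸≋ (s+ _ _) ≈refl ■ s∸s _ _) (λ _ → ≈refl) (a ∷ b ∷ [])

  neg-z : ∀ {n} → neg {n} z ≋ one
  neg-z = ∸-z

  neg-s : ∀ {n} {x : Term n} → neg (s x) ≋ z
  neg-s {x = x} = induction (oneˢ ∸ˢ sˢ #0) zˢ (pˢ #0)
    (λ _ → ∸-s ■ pred≋ ∸-z ■ pred-s) (λ _ → ∸-s) (λ _ → ! pred-z) (x ∷ [])

  sg-z : ∀ {n} → sg {n} z ≋ z
  sg-z = neg≋ neg-z ■ neg-s

  sg-s : ∀ {n} {x : Term n} → sg (s x) ≋ one
  sg-s = neg≋ neg-s ■ neg-z

  cond-same : ∀ {n} (c a : Term n) → cond c a a ≋ a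
  cond-same c a = cases (condˢ #0 #1 #1) #1 (λ _ → cond-z) (λ _ → cond-s) (c ∷ a ∷ [])

  cond-then-nested : ∀ {n} (c a b d : Term n) → cond c (cond c a b) d ≋ cond c a d
  cond-then-nested c a b d = cases (condˢ #0 (condˢ #0 #1 #2) #3) (condˢ #0 #1 #3)
    (λ _ → cond-z ■ ! cond-z) (λ _ → cond-s ■ cond-s ■ ! cond-s) (c ∷ a ∷ b ∷ d ∷ [])

  cond-else-nested : ∀ {n} (c a b : Term n) → cond (neg c) (cond c a b) z ≋ cond (neg c) b z
  cond-else-nested c a b = cases (condˢ (negˢ #0) (condˢ #0 #1 #2) zˢ) (condˢ (negˢ #0) #2 zˢ)
    (λ _ → cond≋ ≈refl cond-z ≈refl)
    (λ _ → cond≋ neg-s ≈refl ≈refl ■ cond-z ■ ! (cond≋ neg-s ≈refl ≈refl ■ cond-z))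
    (c ∷ a ∷ b ∷ [])

  cond-split : ∀ {n} (c L : Term n) → L ≋ cond c (cond c L z) (cond (neg c) L z)
  cond-split c L = cases #1 (condˢ #0 (condˢ #0 #1 zˢ) (condˢ (negˢ #0) #1 zˢ))
    (λ _ → ! (cond-z ■ cond≋ neg-z ≈refl ≈refl ■ cond-s)) (λ _ → ! (cond-s ■ cond-s))
    (c ∷ L ∷ [])

  cond-guard-assoc : ∀ {n} (χ c L : Term n) → cond (cond χ c z) L z ≋ cond χ (cond c L z) z
  cond-guard-assoc χ c L = cases (condˢ (condˢ #0 #1 zˢ) #2 zˢ) (condˢ #0 (condˢ #1 #2 zˢ) zˢ)
    (λ _ → cond≋ cond-z ≈refl ≈refl ■ cond-z ■ ! cond-z)
    (λ _ → cond≋ cond-s ≈refl ≈refl ■ ! cond-s) (χ ∷ c ∷ L ∷ [])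

  cond-sg : ∀ {n} (c a b : Term n) → cond c a b ≋ cond (sg c) a b
  cond-sg c a b = cases (condˢ #0 #1 #2) (condˢ (sgˢ #0) #1 #2)
    (λ _ → cond-z ■ ! (cond≋ sg-z ≈refl ≈refl ■ cond-z))
    (λ _ → cond-s ■ ! (cond≋ sg-s ≈refl ≈refl ■ cond-s)) (c ∷ a ∷ b ∷ [])

  cond-sg-self : ∀ {n} (x : Term n) → x ≋ cond (sg x) x z
  cond-sg-self x = cases #0 (condˢ (sgˢ #0) #0 zˢ)
    (λ _ → ! (cond≋ sg-z ≈refl ≈refl ■ cond-z)) (λ _ → ! (cond≋ sg-s ≈refl ≈refl ■ cond-s))
    (x ∷ [])

  cond-neg-self : ∀ {n} (w : Term n) → w ≋ cond (neg w) z w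
  cond-neg-self w = cases #0 (condˢ (negˢ #0) zˢ #0)
    (λ _ → ! (cond≋ neg-z ≈refl ≈refl ■ cond-s)) (λ _ → ! (cond≋ neg-s ≈refl ≈refl ■ cond-z))
    (w ∷ [])

  cond-sg-then : ∀ {n} (c : Term n) → cond c (sg c) z ≋ cond c one z
  cond-sg-then c = cases (condˢ #0 (sgˢ #0) zˢ) (condˢ #0 oneˢ zˢ)
    (λ _ → cond-z ■ ! cond-z) (λ _ → cond≋ ≈refl sg-s ≈refl) (c ∷ [])

  cond-neg-then : ∀ {n} (c : Term n) → cond (neg c) c z ≋ cond (neg c) z z
  cond-neg-then c = cases (condˢ (negˢ #0) #0 zˢ) (condˢ (negˢ #0) zˢ zˢ)
    (λ _ → ≈refl)
    (λ _ → cond≋ neg-s ≈refl ≈refl ■ cond-z ■ ! (cond≋ neg-s ≈refl ≈refl ■ cond-z)) (c ∷ [])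

  sg-neg : ∀ {n} (c : Term n) → sg (neg c) ≋ neg c
  sg-neg c = cases (sgˢ (negˢ #0)) (negˢ #0)
    (λ _ → sg≋ neg-z ■ sg-s ■ ! neg-z) (λ _ → sg≋ neg-s ■ sg-z ■ ! neg-s) (c ∷ [])

  imp-sg : ∀ {n} (c e : Term n) → imp (sg c) e ≋ cond c (sg e) one
  imp-sg c e = cases (negˢ (sgˢ #0 ∸ˢ #1)) (condˢ #0 (sgˢ #1) oneˢ)
    (λ _ → neg≋ (∸≋ sg-z ≈refl ■ z∸ _) ■ neg-z ■ ! cond-z) (λ _ → neg≋ (∸≋ sg-s ≈refl) ■ ! cond-s)
    (c ∷ e ∷ [])

  and-guard : ∀ {n} (c d L : Term n) → cond (and (sg c) (sg d)) L z ≋ cond c (cond d L z) z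
  and-guard c d L = cases (condˢ (negˢ (negˢ (sgˢ #0) +ˢ negˢ (sgˢ #1))) #2 zˢ)
                          (condˢ #0 (condˢ #1 #2 zˢ) zˢ)
    (λ _ → cond≋ (neg≋ (+≋ (neg≋ sg-z ■ neg-z) ≈refl ■ s+ _ _) ■ neg-s) ≈refl ≈refl
           ■ cond-z ■ ! cond-z)
    (λ _ → cond≋ (neg≋ (+≋ (neg≋ sg-s ■ neg-s) ≈refl ■ z+ _)) ≈refl ≈refl
           ■ ! cond-sg _ _ _ ■ ! cond-sg _ _ _ ■ ! cond-s)
    (c ∷ d ∷ L ∷ [])

  cond-app : ∀ {a n} (f : Fn (Sym T) a) (c : Term n) (ts : Fin a → Term n) →
             cond c (app f ts) z ≋ cond c (app f (λ i → cond c (ts i) z)) z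
  cond-app f c ts = cases (condˢ #0 (termˢ (app f var) (#_ ∘ suc)) zˢ)
                          (condˢ #0 (termˢ (app f var) (λ i → condˢ #0 (# suc i) zˢ)) zˢ)
    (λ _ → cond-z ■ ! cond-z) (λ _ → cond-s ■ ≈cong f (λ i → ! cond-s) ■ ! cond-s) (c ∷ ts)

  -- Dichotomy: exactly one of a > b and a ≤ b holds,
  -- sg (a ∸ b) + sg (b + 1 ∸ a) = 1, by simultaneous descent of a and b.

  dichotomy : ∀ {n} → Term n → Term n → Term n
  dichotomy a b = sg (a ∸' b) +' sg (s b ∸' a)

  dichotomyˢ : ∀ {k} → Sch k → Sch k → Sch k
  dichotomyˢ a b = sgˢ (a ∸ˢ b) +ˢ sgˢ (sˢ b ∸ˢ a)

  dichotomy≋ : ∀ {n} {a a' b b' : Term n} → a ≋ a' → b ≋ b' → dichotomy a b ≋ dichotomy a' b'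
  dichotomy≋ {a = a} {a'} {b} {b'} e₁ e₂ =
    ⟦⟧-cong (dichotomyˢ #0 #1) {a ∷ b ∷ []} {a' ∷ b' ∷ []} (λ { zero → e₁ ; (suc zero) → e₂ })

  dichotomy-z : ∀ {n} (b : Term n) → dichotomy z b ≋ one
  dichotomy-z b = +≋ (sg≋ (z∸ b) ■ sg-z) (sg≋ ∸-z ■ sg-s) ■ z+ one

  dichotomy-by-z : ∀ {n} (a : Term n) → dichotomy a z ≋ one
  dichotomy-by-z a = cases (dichotomyˢ #0 zˢ) oneˢ (λ _ → dichotomy-z z)
    (λ _ → +≋ (sg≋ ∸-z ■ sg-s) (sg≋ neg-s ■ sg-z) ■ +-z) (a ∷ [])

  dichotomy-pred : ∀ {n} (a b : Term n) → dichotomy a b ≋ dichotomy (pred a) (pred b)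
  dichotomy-pred a b = cases (dichotomyˢ #0 #1) (dichotomyˢ (pˢ #0) (pˢ #1))
    (λ _ → dichotomy-z _ ■ ! (dichotomy≋ pred-z ≈refl ■ dichotomy-z _))
    (λ _ → pred-right _ _ ■ ! dichotomy≋ pred-s ≈refl) (a ∷ b ∷ [])
    where
      pred-right : ∀ {n} (a b : Term n) → dichotomy (s a) b ≋ dichotomy a (pred b)
      pred-right a b = cases (dichotomyˢ (sˢ #1) #0) (dichotomyˢ #1 (pˢ #0))
        (λ _ → dichotomy-by-z _ ■ ! (dichotomy≋ ≈refl pred-z ■ dichotomy-by-z _))
        (λ _ → +≋ (sg≋ (s∸s _ _)) (sg≋ (s∸s _ _)) ■ ! dichotomy≋ ≈refl pred-s)
        (b ∷ a ∷ [])

  dichotomy-∸ : ∀ {n} (t x y : Term n) → dichotomy (x ∸' t) (y ∸' t) ≋ dichotomy x y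
  dichotomy-∸ t x y = induction (dichotomyˢ (#1 ∸ˢ #0) (#2 ∸ˢ #0)) (dichotomyˢ #1 #2) #0
    (λ _ → dichotomy≋ ∸-z ∸-z) (λ _ → dichotomy≋ ∸-s ∸-s ■ ! dichotomy-pred _ _) (λ _ → ≈refl)
    (t ∷ x ∷ y ∷ [])

  dichotomy-one : ∀ {n} (x y : Term n) → dichotomy x y ≋ one
  dichotomy-one x y = ! dichotomy-∸ x x y ■ dichotomy≋ (∸-self x) ≈refl ■ dichotomy-z _

  sg-s∸ : ∀ {n} (x y : Term n) → sg (s y ∸' x) ≋ neg (sg (x ∸' y))
  sg-s∸ x y = ! +∸ (sg (x ∸' y)) (sg (s y ∸' x)) ■ ∸≋ (dichotomy-one x y) ≈refl

  ∸+-cancel : ∀ {n} (m y : Term n) → cond (s y ∸' m) ((y ∸' m) +' m) y ≋ y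
  ∸+-cancel m y = induction (condˢ (sˢ #1 ∸ˢ #0) ((#1 ∸ˢ #0) +ˢ #0) #1) #1 (condˢ (#2 ∸ˢ #1) #0 #2)
    (λ _ → cond≋ ∸-z (+-z ■ ∸-z) ≈refl ■ cond-s)
    (λ _ → cond≋ ∸-s (+≋ (∸-s ■ pred≋ (! pred-s∸ _ _)) ≈refl) ≈refl ■ step _ _ _
           ■ ! cond≋ (! pred-s∸ _ _) (cond≋ ≈refl (+≋ (! pred-s∸ _ _) ≈refl) ≈refl) ≈refl)
    (λ _ → ! cond-same _ _)
    (m ∷ y ∷ [])
    where
      step : ∀ {n} (c m y : Term n) →
             cond (pred c) (pred (pred c) +' s m) y ≋ cond (pred c) (cond c (pred c +' m) y) y
      step c m y = cases (condˢ (pˢ #0) (pˢ (pˢ #0) +ˢ sˢ #1) #2)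
                         (condˢ (pˢ #0) (condˢ #0 (pˢ #0 +ˢ #1) #2) #2)
        (λ _ → cond≋ pred-z ≈refl ≈refl ■ cond-z ■ ! (cond≋ pred-z ≈refl ≈refl ■ cond-z))
        (λ _ → cond≋ pred-s (+≋ (pred≋ pred-s) ≈refl) ≈refl ■ shift _ _ _
               ■ ! cond≋ pred-s (cond-s ■ +≋ pred-s ≈refl) ≈refl)
        (c ∷ m ∷ y ∷ [])
        where
          shift : ∀ {n} (c m y : Term n) → cond c (pred c +' s m) y ≋ cond c (c +' m) y
          shift c m y = cases (condˢ #0 (pˢ #0 +ˢ sˢ #1) #2) (condˢ #0 (#0 +ˢ #1) #2)
            (λ _ → cond-z ■ ! cond-z)
            (λ _ → cond-s ■ +≋ pred-s ≈refl ■ +-s ■ ! s+ _ _ ■ ! cond-s) (c ∷ m ∷ y ∷ [])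

  cond-sum-zero : ∀ {n} (v u x y : Term n) →
    cond (neg (u +' v)) x y ≋ cond (neg (u +' v)) (cond (neg (sg u)) (v +' x) y) y
  cond-sum-zero v u x y = cases (condˢ (negˢ (#1 +ˢ #0)) #2 #3)
                                (condˢ (negˢ (#1 +ˢ #0)) (condˢ (negˢ (sgˢ #1)) (#0 +ˢ #2) #3) #3)
    (λ _ → cond≋ (neg≋ +-z) ≈refl ≈refl ■ v-zero _ _ _ ■ ! (cond≋ (neg≋ +-z) ≈refl ≈refl))
    (λ _ → (cond≋ (neg≋ +-s ■ neg-s) ≈refl ≈refl ■ cond-z)
           ■ ! (cond≋ (neg≋ +-s ■ neg-s) ≈refl ≈refl ■ cond-z))
    (v ∷ u ∷ x ∷ y ∷ [])
    where
      v-zero : ∀ {n} (u x y : Term n) →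
               cond (neg u) x y ≋ cond (neg u) (cond (neg (sg u)) (z +' x) y) y
      v-zero u x y = cases (condˢ (negˢ #0) #1 #2)
                           (condˢ (negˢ #0) (condˢ (negˢ (sgˢ #0)) (zˢ +ˢ #1) #2) #2)
        (λ _ → (cond≋ neg-z ≈refl ≈refl ■ cond-s)
               ■ ! (cond≋ neg-z ≈refl ≈refl ■ cond-s ■ cond≋ (neg≋ sg-z ■ neg-z) ≈refl ≈refl
                    ■ cond-s ■ z+ _))
        (λ _ → (cond≋ neg-s ≈refl ≈refl ■ cond-z) ■ ! (cond≋ neg-s ≈refl ≈refl ■ cond-z))
        (u ∷ x ∷ y ∷ [])

  eq-reflect : ∀ {n} (x y : Term n) → cond (eq x y) x y ≋ y
  eq-reflect x y = cond-sum-zero (y ∸' x) (x ∸' y) x y ■ cond≋ ≈refl (! y-recovered) ≈refl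
                   ■ cond-same _ _
    where
      y-recovered : y ≋ cond (neg (sg (x ∸' y))) ((y ∸' x) +' x) y
      y-recovered = ! ∸+-cancel x y ■ cond-sg _ _ _ ■ cond≋ (sg-s∸ x y) ≈refl ≈refl

  eq-refl : ∀ {n} (u : Term n) → eq u u ≋ one
  eq-refl u = neg≋ (+≋ (∸-self u) (∸-self u) ■ +-z) ■ neg-z

-- Guarded equality: χ ⊨ a ≐ b says that a and b agree wherever χ ≠ 0,
-- i.e. cond χ a 0 = cond χ b 0 is provable.  It is a congruence, and
-- guards obey the rules of a natural-deduction calculus (weakening,
-- case splits, modus ponens), which is how all conditional reasoning
-- about the predicates of the theorem is carried out.
module Guarded (T : Theory) where

  open Equational T
  open Schemes T
  open Arithmetic T

  infix 3 _⊨_≐_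
  _⊨_≐_ : ∀ {n} → Term n → Term n → Term n → Set
  χ ⊨ a ≐ b = cond χ a z ≋ cond χ b z

  infixl 4 _&_
  _&_ : ∀ {n} → Term n → Term n → Term n
  χ & c = cond χ c z

  module _ {n : ℕ} {χ : Term n} where

    ⊨-refl : ∀ {a} → χ ⊨ a ≐ a
    ⊨-refl = ≈refl

    ⊨-sym : ∀ {a b} → χ ⊨ a ≐ b → χ ⊨ b ≐ a
    ⊨-sym p = ! p

    ⊨-trans : ∀ {a b c} → χ ⊨ a ≐ b → χ ⊨ b ≐ c → χ ⊨ a ≐ c
    ⊨-trans p q = p ■ q

    ≋⇒⊨ : ∀ {a b} → a ≋ b → χ ⊨ a ≐ b
    ≋⇒⊨ e = cond≋ ≈refl e ≈refl

    ⊨-app : ∀ {a} (f : Fn (Sym T) a) {ts us : Fin a → Term n} →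
            (∀ i → χ ⊨ ts i ≐ us i) → χ ⊨ app f ts ≐ app f us
    ⊨-app f {ts} {us} E = cond-app f χ ts ■ cond≋ ≈refl (≈cong f E) ≈refl ■ ! cond-app f χ us

    ⊨-subst : ∀ {j} (t : Term j) {σ τ : Fin j → Term n} →
              (∀ i → χ ⊨ σ i ≐ τ i) → χ ⊨ t [ σ ] ≐ t [ τ ]
    ⊨-subst (var i)    E = E i
    ⊨-subst (app f ts) E = ⊨-app f (λ i → ⊨-subst (ts i) E)

    ⊨-cond : ∀ {a a' b b' c c'} → χ ⊨ a ≐ a' → χ ⊨ b ≐ b' → χ ⊨ c ≐ c' →
             χ ⊨ cond a b c ≐ cond a' b' c'
    ⊨-cond p q r = ⊨-app condF (λ { zero → p ; (suc zero) → q ; (suc (suc zero)) → r })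

    ⊨-∸ : ∀ {a a' b b'} → χ ⊨ a ≐ a' → χ ⊨ b ≐ b' → χ ⊨ a ∸' b ≐ a' ∸' b'
    ⊨-∸ p q = ⊨-app subF (λ { zero → q ; (suc zero) → p })

    ⊨-+ : ∀ {a a' b b'} → χ ⊨ a ≐ a' → χ ⊨ b ≐ b' → χ ⊨ a +' b ≐ a' +' b'
    ⊨-+ p q = ⊨-app addF (λ { zero → q ; (suc zero) → p })

    ⊨-neg : ∀ {a a'} → χ ⊨ a ≐ a' → χ ⊨ neg a ≐ neg a'
    ⊨-neg p = ⊨-∸ ⊨-refl p

  ⊨-guard≋ : ∀ {n} {χ χ' a b : Term n} → χ ≋ χ' → χ ⊨ a ≐ b → χ' ⊨ a ≐ b
  ⊨-guard≋ e p = ! cond≋ e ≈refl ≈refl ■ p ■ cond≋ e ≈refl ≈refl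

  ⊨-curry : ∀ {n} {χ c a b : Term n} → χ & c ⊨ a ≐ b → χ ⊨ cond c a z ≐ cond c b z
  ⊨-curry {χ = χ} {c} {a} {b} p = ! cond-guard-assoc χ c a ■ p ■ cond-guard-assoc χ c b

  ⊨-uncurry : ∀ {n} {χ c a b : Term n} → χ ⊨ cond c a z ≐ cond c b z → χ & c ⊨ a ≐ b
  ⊨-uncurry {χ = χ} {c} {a} {b} p = cond-guard-assoc χ c a ■ p ■ ! cond-guard-assoc χ c b

  ⊨-weakenˡ : ∀ {n} {χ c a b : Term n} → χ ⊨ a ≐ b → χ & c ⊨ a ≐ b
  ⊨-weakenˡ p = ⊨-uncurry (⊨-cond ⊨-refl p ⊨-refl)

  ⊨-weakenʳ : ∀ {n} {χ c a b : Term n} → c ⊨ a ≐ b → χ & c ⊨ a ≐ b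
  ⊨-weakenʳ p = ⊨-uncurry (≋⇒⊨ p)

  ⊨-split : ∀ {n} {χ c a b : Term n} → χ & c ⊨ a ≐ b → χ & neg c ⊨ a ≐ b → χ ⊨ a ≐ b
  ⊨-split {c = c} {a} {b} p q = ⊨-trans (≋⇒⊨ (cond-split c a))
    (⊨-trans (⊨-cond ⊨-refl (⊨-curry p) (⊨-curry q)) (≋⇒⊨ (! cond-split c b)))

  ⊨-split₀ : ∀ {n} {c a b : Term n} → c ⊨ a ≐ b → neg c ⊨ a ≐ b → a ≋ b
  ⊨-split₀ {c = c} {a} {b} p q = cond-split c a ■ cond≋ ≈refl p q ■ ! cond-split c b

  ⊨-hyp : ∀ {n} (c : Term n) → c ⊨ sg c ≐ one
  ⊨-hyp c = cond-sg-then c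

  ⊨-hyp-neg : ∀ {n} (c : Term n) → neg c ⊨ c ≐ z
  ⊨-hyp-neg c = cond-neg-then c

  ⊨-cond-then : ∀ {n} (c a b : Term n) → c ⊨ cond c a b ≐ a
  ⊨-cond-then c a b = cond-then-nested c a b z

  ⊨-cond-else : ∀ {n} (c a b : Term n) → neg c ⊨ cond c a b ≐ b
  ⊨-cond-else c a b = cond-else-nested c a b

  ⊨-mp : ∀ {n} {χ c a b : Term n} → χ ⊨ c ≐ one → c ⊨ a ≐ b → χ ⊨ a ≐ b
  ⊨-mp p q = ⊨-trans (⊨-trans (≋⇒⊨ (! cond-s)) (⊨-sym (⊨-cond p ⊨-refl ⊨-refl)))
                     (⊨-trans (≋⇒⊨ q) (⊨-trans (⊨-cond p ⊨-refl ⊨-refl) (≋⇒⊨ cond-s)))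

  ⊨-absurd : ∀ {n} {χ a b : Term n} → χ ⊨ one ≐ z → χ ⊨ a ≐ b
  ⊨-absurd p = ⊨-trans (≋⇒⊨ (! cond-s)) (⊨-trans (⊨-cond p ⊨-refl ⊨-refl) (≋⇒⊨ cond-z))

  ⊨-neg-one : ∀ {n} {χ w : Term n} → χ ⊨ neg w ≐ one → χ ⊨ w ≐ z
  ⊨-neg-one {w = w} p =
    ⊨-trans (≋⇒⊨ (cond-neg-self w)) (⊨-trans (⊨-cond p ⊨-refl ⊨-refl) (≋⇒⊨ cond-s))

  ⊨-sg-zero : ∀ {n} {χ w : Term n} → χ ⊨ sg w ≐ z → χ ⊨ w ≐ z
  ⊨-sg-zero {w = w} p =
    ⊨-trans (≋⇒⊨ (cond-sg-self w)) (⊨-trans (⊨-cond p ⊨-refl ⊨-refl) (≋⇒⊨ cond-z))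

  ⊨-eq-elim : ∀ {n} {χ t u : Term n} → χ ⊨ eq t u ≐ one → χ ⊨ t ≐ u
  ⊨-eq-elim {t = t} {u} p =
    ⊨-sym (⊨-trans (≋⇒⊨ (! eq-reflect t u)) (⊨-trans (⊨-cond p ⊨-refl ⊨-refl) (≋⇒⊨ cond-s)))

  ⊨-eq-intro : ∀ {n} {χ t u : Term n} → χ ⊨ t ≐ u → χ ⊨ eq t u ≐ one
  ⊨-eq-intro p = ⊨-trans (⊨-neg (⊨-+ (⊨-∸ p ⊨-refl) (⊨-∸ ⊨-refl p))) (≋⇒⊨ (eq-refl _))

  ⊨-le-intro : ∀ {n} {χ x y : Term n} → χ ⊨ x ∸' y ≐ z → χ ⊨ le x y ≐ one
  ⊨-le-intro p = ⊨-trans (⊨-neg p) (≋⇒⊨ neg-z)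

  ⊨-antisym : ∀ {n} {χ x y : Term n} → χ ⊨ le x y ≐ one → χ ⊨ le y x ≐ one → χ ⊨ x ≐ y
  ⊨-antisym p q = ⊨-eq-elim
    (⊨-trans (⊨-neg (⊨-+ (⊨-neg-one p) (⊨-neg-one q))) (≋⇒⊨ (neg≋ +-z ■ neg-z)))

  IsBool : ∀ {n} → Term n → Set
  IsBool b = b ≋ sg b

  neg-bool : ∀ {n} (x : Term n) → IsBool (neg x)
  neg-bool x = ! sg-neg x

  ⊨-bool-hyp : ∀ {n} {c : Term n} → IsBool c → c ⊨ c ≐ one
  ⊨-bool-hyp {c = c} b = ⊨-trans (≋⇒⊨ b) (⊨-hyp c)

  pred⇒bool : ∀ {n} {x : Term n} → IsPred T x → IsBool x
  pred⇒bool {x = x} p = split-at-one ■ cond≋ x≤1 ≈refl ≈refl ■ cond-z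
    where
      x≤1 : x ∸' one ≋ z
      x≤1 = cond-neg-self (x ∸' one) ■ cond≋ p ≈refl ≈refl ■ cond-s
      split-at-one : x ≋ cond (x ∸' one) x (sg x)
      split-at-one = cases #0 (condˢ (#0 ∸ˢ oneˢ) #0 (sgˢ #0))
        (λ _ → ! (cond≋ (z∸ one) ≈refl ≈refl ■ cond-z ■ sg-z))
        (λ _ → split-at-zero _ ■ ! cond≋ (s∸s _ _ ■ ∸-z) ≈refl ≈refl) (x ∷ [])
        where
          split-at-zero : ∀ {n} (y : Term n) → s y ≋ cond y (s y) (sg (s y))
          split-at-zero y = cases (sˢ #0) (condˢ #0 (sˢ #0) (sgˢ (sˢ #0)))
            (λ _ → ! (cond-z ■ sg-s)) (λ _ → ! cond-s) (y ∷ [])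

  one-subst : ∀ {n m} (σ : Fin n → Term m) → one [ σ ] ≋ one
  one-subst σ = ⟦⟧-subst oneˢ [] σ

  pred-subst-bool : ∀ {n m} {x : Term n} → IsPred T x → (σ : Fin n → Term m) → IsBool (x [ σ ])
  pred-subst-bool {x = x} p σ =
    pred⇒bool (! ⟦⟧-subst (negˢ (#0 ∸ˢ oneˢ)) (x ∷ []) σ ■ ≈subst σ p ■ one-subst σ)

  imp-as-cond : ∀ {n} {p q : Term n} → IsBool p → imp p q ≋ cond p (sg q) one
  imp-as-cond {p = p} {q} b = neg≋ (∸≋ b ≈refl) ■ imp-sg p q

  imp-intro : ∀ {n} {χ e : Term n} → IsBool χ → χ ⊨ e ≐ one → imp χ e ≋ one
  imp-intro {χ = χ} {e} b p = imp-as-cond b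
    ■ ! cond-then-nested χ (sg e) z one
    ■ cond≋ ≈refl (⊨-trans (⊨-neg (⊨-neg p)) (≋⇒⊨ sg-s)) ≈refl
    ■ cond-then-nested χ one z one ■ cond-same χ one

  imp-elim : ∀ {n} {χ e : Term n} → IsBool χ → imp χ e ≋ one → χ ⊨ sg e ≐ one
  imp-elim {χ = χ} {e} b p = ! cond-then-nested χ (sg e) one z
    ■ cond≋ ≈refl (! imp-as-cond b ■ p) ≈refl

  ⊨-imp-elim : ∀ {n} {χ p q : Term n} → IsBool p → χ ⊨ imp p q ≐ one → χ & p ⊨ sg q ≐ one
  ⊨-imp-elim {p = p} {q} b h = ⊨-trans (⊨-sym (⊨-weakenʳ (⊨-cond-then p (sg q) one)))
    (⊨-weakenˡ (⊨-trans (≋⇒⊨ (! imp-as-cond b)) h))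

  ⊨-imp-intro : ∀ {n} {χ p q : Term n} → IsBool p → χ & p ⊨ sg q ≐ one → χ ⊨ imp p q ≐ one
  ⊨-imp-intro {p = p} {q} b h = ⊨-trans (≋⇒⊨ (imp-as-cond b))
    (⊨-split (⊨-trans (⊨-weakenʳ (⊨-cond-then p (sg q) one)) h)
             (⊨-weakenʳ (⊨-cond-else p (sg q) one)))

  -- For boolean χ, equality on {χ} (Defs: T ⊢[ χ ] t ≈ u) is guarded equality.
  ⊢[]-intro : ∀ {n} {χ t u : Term n} → IsBool χ → χ ⊨ t ≐ u → T ⊢[ χ ] t ≈ u
  ⊢[]-intro b p = imp-intro b (⊨-eq-intro p)

  ⊢[]-elim : ∀ {n} {χ t u : Term n} → IsBool χ → T ⊢[ χ ] t ≈ u → χ ⊨ t ≐ u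
  ⊢[]-elim b p = ⊨-eq-elim (⊨-trans (≋⇒⊨ (! sg-neg _)) (imp-elim b p))

  ⊢[]ˢ : Sch 3
  ⊢[]ˢ = negˢ (#0 ∸ˢ negˢ ((#1 ∸ˢ #2) +ˢ (#2 ∸ˢ #1)))

  ⊢[]-instantiate : ∀ {n} (χ : Term n) (p q : Term (suc n)) (t : Term n) →
                    T ⊢[ wk χ ] p ≈ q → T ⊢[ χ ] (p [ t ∷ var ]) ≈ (q [ t ∷ var ])
  ⊢[]-instantiate χ p q t h =
    ! (⟦⟧-subst ⊢[]ˢ ρ (t ∷ var)
       ■ ⟦⟧-cong ⊢[]ˢ {λ i → ρ i [ t ∷ var ]} {χ ∷ p [ t ∷ var ] ∷ q [ t ∷ var ] ∷ []}
           (λ { zero → wk-inst χ t ; (suc zero) → ≈refl ; (suc (suc zero)) → ≈refl }))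
    ■ ≈subst (t ∷ var) h ■ one-subst (t ∷ var)
    where
      ρ = wk χ ∷ p ∷ q ∷ []

  ⊢[]-resp : ∀ {n} {χ t t' u u' : Term n} → t ≋ t' → u ≋ u' → T ⊢[ χ ] t ≈ u → T ⊢[ χ ] t' ≈ u'
  ⊢[]-resp {χ = χ} {t} {t'} {u} {u'} e₁ e₂ h =
    ! ⟦⟧-cong ⊢[]ˢ {χ ∷ t ∷ u ∷ []} {χ ∷ t' ∷ u' ∷ []}
        (λ { zero → ≈refl ; (suc zero) → e₁ ; (suc (suc zero)) → e₂ }) ■ h

  ⊨-and : ∀ {n} {p q a b : Term n} → IsBool p → IsBool q → p & q ⊨ a ≐ b → and p q ⊨ a ≐ b
  ⊨-and {p = p} {q} {a} {b} bp bq r = as-guards a ■ ! cond-guard-assoc p q a ■ r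
                                      ■ cond-guard-assoc p q b ■ ! as-guards b
    where
      as-guards : ∀ x → cond (and p q) x z ≋ cond p (cond q x z) z
      as-guards x = cond≋ (neg≋ (+≋ (neg≋ bp) (neg≋ bq))) ≈refl ≈refl ■ and-guard p q x

  eqv-bool : ∀ {j n} (σ τ : Fin j → Term n) → IsBool (eqv σ τ)
  eqv-bool {zero}  σ τ = ! sg-s
  eqv-bool {suc j} σ τ = neg-bool _

  ⊨-eqv : ∀ {j n} (σ τ : Fin j → Term n) i → eqv σ τ ⊨ σ i ≐ τ i
  ⊨-eqv {suc j} σ τ zero =
    ⊨-and (neg-bool _) (eqv-bool _ _) (⊨-weakenˡ (⊨-eq-elim (⊨-bool-hyp (neg-bool _))))
  ⊨-eqv {suc j} σ τ (suc i) =
    ⊨-and (neg-bool _) (eqv-bool _ _) (⊨-weakenʳ (⊨-eqv (σ ∘ suc) (τ ∘ suc) i))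

  vanishing-induction : ∀ {k} (e : Sch (suc k)) →
    Valid (e ⟪ at-zero ⟫) zˢ →
    (∀ {m} (ρ : Fin (suc k) → Term m) → neg (⟦ e ⟧ ρ) ⊨ ⟦ e ⟪ at-suc ⟫ ⟧ ρ ≐ z) →
    Valid e zˢ
  vanishing-induction e base step = induction e zˢ H base recurrence (λ _ → ! cond-z)
    where
      H = condˢ #0 (e ⟪ at-suc ⟫ ⟪ #_ ∘ suc ⟫) zˢ
      recurrence : Valid (e ⟪ at-suc ⟫) (H ⟪ e ∷ #_ ⟫)
      recurrence ρ = cond-split c L ■ cond≋ ≈refl ≈refl (step ρ) ■ cond≋ ≈refl ≈refl (cond-same _ _)
        ■ cond-then-nested c L z z
        ■ ! cond≋ ≈refl (⟦⟧-⟪⟫ (e ⟪ at-suc ⟫ ⟪ #_ ∘ suc ⟫) (e ∷ #_) ρ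
                         ■ ⟦⟧-⟪⟫ (e ⟪ at-suc ⟫) (#_ ∘ suc) _) ≈refl
        where
          c = ⟦ e ⟧ ρ
          L = ⟦ e ⟪ at-suc ⟫ ⟧ ρ

module Minimisation (T : Theory) {k : ℕ} (φ : Tm (Sym T) (suc k)) (φ-pred : IsPred T φ) where

  open Equational T
  open Schemes T
  open Arithmetic T
  open Guarded T

  bmin : ∀ {m} → Term m → (Fin k → Term m) → Term m
  bmin n a = app (bminF φ) (n ∷ a)

  Φ Φmin : ∀ {m} → Term m → (Fin k → Term m) → Term m
  Φ n a = φ [ n ∷ a ]
  Φmin n a = Φ (bmin n a) a

  φ-bool : ∀ {m} (σ : Fin (suc k) → Term m) → IsBool (φ [ σ ])
  φ-bool σ = pred-subst-bool φ-pred σ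

  φ-η : ∀ {m} {σ : Fin (suc k) → Term m} → φ [ σ ] ≋ Φ (σ zero) (σ ∘ suc)
  φ-η = subst-cong φ (λ { zero → ≈refl ; (suc i) → ≈refl })

  bmin-η : ∀ {m} (σ : Fin (suc k) → Term m) → app (bminF φ) σ ≋ bmin (σ zero) (σ ∘ suc)
  bmin-η σ = ≈cong (bminF φ) (λ { zero → ≈refl ; (suc i) → ≈refl })

  bmin-z : ∀ {m} (a : Fin k → Term m) → bmin z a ≋ z
  bmin-z a = rec0 _ _ ■ comp Z [] ■ ≈cong Z (λ ())

  bmin-s : ∀ {m} (n : Term m) (a : Fin k → Term m) →
           bmin (s n) a ≋ cond (Φmin n a) (bmin n a) (s n)
  bmin-s n a = recS _ _ ■ lam-app _ _
    ■ ≈cong condF (λ { zero → subst-subst φ ■ φ-η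
                     ; (suc zero) → ≈refl
                     ; (suc (suc zero)) → ≈cong S (λ { zero → ≈refl }) })

  bmin-found : ∀ {m} (n : Term m) a → Φmin n a ⊨ bmin (s n) a ≐ bmin n a
  bmin-found n a = ⊨-trans (≋⇒⊨ (bmin-s n a)) (⊨-cond-then _ _ _)

  bmin-missed : ∀ {m} (n : Term m) a → neg (Φmin n a) ⊨ bmin (s n) a ≐ s n
  bmin-missed n a = ⊨-trans (≋⇒⊨ (bmin-s n a)) (⊨-cond-else _ _ _)

  bmin-fix : ∀ {m} (n : Term m) (a : Fin k → Term m) → bmin n a ≋ cond (Φmin n a) (bmin n a) n
  bmin-fix n a = by-cases (n ∷ a) ■ cond≋ φ-η ≈refl ≈refl
    where
      bminˢ : Sch (suc k)
      bminˢ = termˢ (app (bminF φ) var) #_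
      by-cases : Valid bminˢ (condˢ (termˢ φ (bminˢ ∷ (#_ ∘ suc))) bminˢ #0)
      by-cases = cases bminˢ (condˢ (termˢ φ (bminˢ ∷ (#_ ∘ suc))) bminˢ #0)
        (λ _ → (bmin-η _ ■ bmin-z _) ■ ! (cond≋ ≈refl (bmin-η _ ■ bmin-z _) ≈refl ■ cond-same _ _))
        (λ _ → bmin-η _ ■ fix-s _ _
               ■ ! cond≋ (subst-cong φ (λ { zero → bmin-η _ ; (suc i) → ≈refl })) (bmin-η _) ≈refl)
        where
          fix-s : ∀ {m} (n : Term m) a → bmin (s n) a ≋ cond (Φmin (s n) a) (bmin (s n) a) (s n)
          fix-s n a = ⊨-split₀ {c = Φmin n a} found missed
            where
              φ-at-s : Φmin n a ⊨ Φmin (s n) a ≐ one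
              φ-at-s = ⊨-trans (⊨-subst φ (λ { zero → bmin-found n a ; (suc i) → ⊨-refl }))
                               (⊨-bool-hyp (φ-bool _))
              found : Φmin n a ⊨ bmin (s n) a ≐ cond (Φmin (s n) a) (bmin (s n) a) (s n)
              found = ⊨-trans (bmin-found n a)
                (⊨-sym (⊨-trans (⊨-cond φ-at-s (bmin-found n a) ⊨-refl) (≋⇒⊨ cond-s)))
              missed : neg (Φmin n a) ⊨ bmin (s n) a ≐ cond (Φmin (s n) a) (bmin (s n) a) (s n)
              missed = ⊨-trans (bmin-missed n a)
                (⊨-sym (⊨-trans (⊨-cond ⊨-refl (bmin-missed n a) ⊨-refl) (≋⇒⊨ (cond-same _ _))))

  bmin-missed-self : ∀ {m} (n : Term m) a → neg (Φmin n a) ⊨ bmin n a ≐ n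
  bmin-missed-self n a = ⊨-trans (≋⇒⊨ (bmin-fix n a)) (⊨-cond-else _ _ _)

  Φ-missed : ∀ {m} (n : Term m) a → neg (Φmin n a) ⊨ Φ n a ≐ z
  Φ-missed n a = ⊨-trans (⊨-sym (⊨-subst φ (λ { zero → bmin-missed-self n a ; (suc i) → ⊨-refl })))
                         (⊨-hyp-neg _)

  bmin-witness : ∀ {m} (n : Term m) a → Φ n a ⊨ Φmin n a ≐ one
  bmin-witness n a =
    ⊨-split {c = Φmin n a} (⊨-weakenʳ (⊨-bool-hyp (φ-bool _))) (⊨-absurd contradiction)
    where
      contradiction : Φ n a & neg (Φmin n a) ⊨ one ≐ z
      contradiction =
        ⊨-trans (⊨-sym (⊨-weakenˡ (⊨-bool-hyp (φ-bool _)))) (⊨-weakenʳ (Φ-missed n a))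

  s-below : ∀ {m'} {χ : Term m'} (n m : Term m') a → χ ⊨ n ∸' m ≐ z →
            χ ⊨ Φ n a ≐ z → χ ⊨ Φ m a ≐ one → χ ⊨ s n ∸' m ≐ z
  s-below {χ = χ} n m a n≤m ¬φn φm =
    ⊨-split {c = s n ∸' m} (⊨-absurd one≐z) (⊨-weakenʳ (⊨-hyp-neg _))
    where
      n≐m : χ & (s n ∸' m) ⊨ n ≐ m
      n≐m = ⊨-antisym (⊨-weakenˡ (⊨-le-intro n≤m))
        (⊨-le-intro (⊨-sg-zero (⊨-neg-one (⊨-trans (≋⇒⊨ (! sg-s∸ m n)) (⊨-weakenʳ (⊨-hyp _))))))
      one≐z : χ & (s n ∸' m) ⊨ one ≐ z
      one≐z = ⊨-trans (⊨-sym (⊨-weakenˡ φm))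
        (⊨-trans (⊨-sym (⊨-subst φ (λ { zero → n≐m ; (suc i) → ⊨-refl }))) (⊨-weakenˡ ¬φn))

  -- Induction step for minimality: with Q(n) = [φ(a, m) ∧ m < bmin(n, a)],
  -- wherever Q(n) fails, so does Q(n + 1).
  bmin-least-step : ∀ {m'} (n m : Term m') (a : Fin k → Term m') →
    neg (cond (Φ m a) (bmin n a ∸' m) z) ⊨ cond (Φ m a) (bmin (s n) a ∸' m) z ≐ z
  bmin-least-step n m a = ⊨-split {c = Φ m a} with-φm without-φm
    where
      χ = neg (cond (Φ m a) (bmin n a ∸' m) z)
      ψ = χ & Φ m a
      without-φm : χ & neg (Φ m a) ⊨ cond (Φ m a) (bmin (s n) a ∸' m) z ≐ z
      without-φm = ⊨-weakenʳ (⊨-trans (⊨-cond (⊨-hyp-neg _) ⊨-refl ⊨-refl) (≋⇒⊨ cond-z))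
      φm : ψ ⊨ Φ m a ≐ one
      φm = ⊨-weakenʳ (⊨-bool-hyp (φ-bool _))
      bmin-n≤m : ψ ⊨ bmin n a ∸' m ≐ z
      bmin-n≤m = ⊨-trans (⊨-sym (⊨-weakenʳ (⊨-cond-then (Φ m a) _ z))) (⊨-weakenˡ (⊨-hyp-neg _))
      bmin-s≤m : ψ ⊨ bmin (s n) a ∸' m ≐ z
      bmin-s≤m = ⊨-split {c = Φmin n a}
        (⊨-trans (⊨-∸ (⊨-weakenʳ (bmin-found n a)) ⊨-refl) (⊨-weakenˡ bmin-n≤m))
        (⊨-trans (⊨-∸ (⊨-weakenʳ (bmin-missed n a)) ⊨-refl)
          (s-below n m a
            (⊨-trans (⊨-∸ (⊨-weakenʳ (⊨-sym (bmin-missed-self n a))) ⊨-refl) (⊨-weakenˡ bmin-n≤m))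
            (⊨-weakenʳ (Φ-missed n a)) (⊨-weakenˡ φm)))
      with-φm : ψ ⊨ cond (Φ m a) (bmin (s n) a ∸' m) z ≐ z
      with-φm = ⊨-trans (⊨-weakenʳ (⊨-cond-then (Φ m a) _ z)) bmin-s≤m

  bmin-least : ∀ {m'} (n m : Term m') (a : Fin k → Term m') → Φ m a ⊨ le (bmin n a) m ≐ one
  bmin-least n m a = ⊨-le-intro (! Q-inst (n ∷ m ∷ a) ■ Q-vanishes (n ∷ m ∷ a) ■ ! cond-same _ _)
    where
      params : Fin k → Sch (suc (suc k))
      params i = # suc (suc i)
      Q : Sch (suc (suc k))
      Q = condˢ (termˢ φ (#1 ∷ params)) (termˢ (app (bminF φ) var) (#0 ∷ params) ∸ˢ #1) zˢ
      Q-inst : ∀ {m''} (ρ : Fin (suc (suc k)) → Term m'') →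
        ⟦ Q ⟧ ρ ≋ cond (Φ (ρ (suc zero)) (λ i → ρ (suc (suc i))))
                       (bmin (ρ zero) (λ i → ρ (suc (suc i))) ∸' ρ (suc zero)) z
      Q-inst ρ = cond≋ φ-η (∸≋ (bmin-η _) ≈refl) ≈refl
      Q-vanishes : Valid Q zˢ
      Q-vanishes = vanishing-induction Q
        (λ _ → cond≋ ≈refl (∸≋ (bmin-η _ ■ bmin-z _) ≈refl ■ z∸ _) ≈refl ■ cond-same _ _)
        (λ ρ → ⊨-guard≋ (neg≋ (! Q-inst ρ))
                 (⊨-trans (≋⇒⊨ (cond≋ φ-η (∸≋ (bmin-η _) ≈refl) ≈refl)) (bmin-least-step _ _ _)))

  bmin-unique : ∀ {m} (n n' : Term m) (a : Fin k → Term m) →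
                Φ n a & Φ n' a ⊨ bmin n a ≐ bmin n' a
  bmin-unique n n' a = ⊨-antisym
    (⊨-weakenʳ (⊨-mp (bmin-witness n' a) (bmin-least n (bmin n' a) a)))
    (⊨-weakenˡ (⊨-mp (bmin-witness n a) (bmin-least n' (bmin n a) a)))

  μ̂ : Term (suc k)
  μ̂ = fhat (μ φ)

  μ-witness : T ⊢[ φ ] φ [ μ̂ ∷ (var ∘ suc) ] ≈ one
  μ-witness = ⊢[]-intro (pred⇒bool φ-pred)
    (⊨-guard≋ (! φ-η ■ subst-var φ)
      (⊨-trans (≋⇒⊨ (subst-cong φ (λ { zero → bmin-η var ; (suc i) → ≈refl })))
               (bmin-witness (var zero) (var ∘ suc))))

  μ-least : T ⊢[ wk φ ] imp (φ [ var zero ∷ (wk ∘ (var ∘ suc)) ]) (le (wk μ̂) (var zero)) ≈ one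
  μ-least = ⊢[]-intro (φ-bool _) (⊨-imp-intro (φ-bool _) (⊨-weakenʳ
    (⊨-trans (≋⇒⊨ (sg-neg _))
      (⊨-trans (⊨-neg (⊨-∸ (≋⇒⊨ (bmin-η _)) ⊨-refl))
               (bmin-least (var (suc zero)) (var zero) (λ i → var (suc (suc i))))))))

  μ-functional : T ⊢[ and (inL φ) (inR φ) ]
    imp (eqv (inL ∘ (var ∘ suc)) (inR ∘ (var ∘ suc))) (eq (inL μ̂) (inR μ̂)) ≈ one
  μ-functional = ⊢[]-intro (neg-bool _) (⊨-imp-intro (eqv-bool _ _)
                   (⊨-trans (≋⇒⊨ (sg-neg _)) (⊨-eq-intro same-value)))
    where
      σL σR : Fin (suc k) → Term (suc k + suc k)
      σL i = var (i ↑ˡ suc k)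
      σR i = var (suc k ↑ʳ i)
      -- θ: both sides in D and equal parameters; then both values are
      -- searches with the left parameters, up to bounds at which φ holds
      θ = and (inL φ) (inR φ) & eqv (σL ∘ suc) (σR ∘ suc)
      params : ∀ i → θ ⊨ σL (suc i) ≐ σR (suc i)
      params i = ⊨-weakenʳ (⊨-eqv (σL ∘ suc) (σR ∘ suc) i)
      φL : θ ⊨ Φ (σL zero) (σL ∘ suc) ≐ one
      φL = ⊨-weakenˡ (⊨-and (φ-bool _) (φ-bool _)
             (⊨-weakenˡ (⊨-trans (≋⇒⊨ (! φ-η)) (⊨-bool-hyp (φ-bool σL)))))
      φR : θ ⊨ Φ (σR zero) (σL ∘ suc) ≐ one
      φR = ⊨-trans (⊨-subst φ (λ { zero → ⊨-refl ; (suc i) → params i }))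
             (⊨-weakenˡ (⊨-and (φ-bool _) (φ-bool _)
               (⊨-weakenʳ (⊨-trans (≋⇒⊨ (! φ-η)) (⊨-bool-hyp (φ-bool σR))))))
      both : θ ⊨ Φ (σL zero) (σL ∘ suc) & Φ (σR zero) (σL ∘ suc) ≐ one
      both = ⊨-trans (⊨-cond φL φR ⊨-refl) (≋⇒⊨ cond-s)
      same-value : θ ⊨ inL μ̂ ≐ inR μ̂
      same-value = ⊨-trans (≋⇒⊨ (bmin-η _))
        (⊨-trans (⊨-mp both (bmin-unique _ _ _))
          (⊨-trans (⊨-app (bminF φ) (λ { zero → ⊨-refl ; (suc i) → params i })) (≋⇒⊨ (! bmin-η _))))

  -- Universality: any f with the two properties of a least witness is
  -- included in μφ via â ↦ (f̂(â), d_f(â)); on D_f, bmin(f̂, d_f) = f̂.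
  μ-universal : (f : RawPMap (Sym T) k) → IsPMap T f → MinSpec T φ f → _⊆̂_ T f (μ φ)
  μ-universal f (δ-pred , _) (witness , least) =
    (fhat f ∷ d f) , witness , (λ _ → ⊢[]-intro δ-bool ⊨-refl) , ⊢[]-intro δ-bool agree
    where
      δ-bool = pred⇒bool δ-pred
      b = bmin (fhat f) (d f)
      -- φ holds at f̂, so the search up to f̂ stops no later than f̂
      b≤f̂ : δ f ⊨ le b (fhat f) ≐ one
      b≤f̂ = ⊨-mp (⊢[]-elim δ-bool witness) (bmin-least (fhat f) (fhat f) (d f))
      leˢ : Sch 3
      leˢ = negˢ (#0 ∸ˢ negˢ (#1 ∸ˢ #2))
      -- minimality of f̂, instantiated at n := b
      least-at-b : δ f ⊨ imp (Φmin (fhat f) (d f)) (le (fhat f) b) ≐ one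
      least-at-b = ⊢[]-elim δ-bool (⊢[]-resp instance≋ (one-subst _)
                     (⊢[]-instantiate (δ f) _ one b least))
        where
          ρ = φ [ var zero ∷ (wk ∘ d f) ] ∷ wk (fhat f) ∷ var zero ∷ []
          instance≋ : ⟦ leˢ ⟧ ρ [ b ∷ var ] ≋ imp (Φmin (fhat f) (d f)) (le (fhat f) b)
          instance≋ = ⟦⟧-subst leˢ ρ (b ∷ var)
            ■ ⟦⟧-cong leˢ {λ i → ρ i [ b ∷ var ]} {Φmin (fhat f) (d f) ∷ fhat f ∷ b ∷ []}
                (λ { zero → subst-subst φ
                              ■ subst-cong φ (λ { zero → ≈refl ; (suc i) → wk-inst (d f i) b })
                   ; (suc zero) → wk-inst (fhat f) b
                   ; (suc (suc zero)) → ≈refl })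
      -- if the search succeeds then b ≤ f̂ ≤ b; otherwise it returns its bound f̂
      agree : δ f ⊨ b ≐ fhat f
      agree = ⊨-split {c = Φmin (fhat f) (d f)}
        (⊨-antisym (⊨-weakenˡ b≤f̂) (⊨-trans (≋⇒⊨ (! sg-neg _)) (⊨-imp-elim (φ-bool _) least-at-b)))
        (⊨-weakenʳ (bmin-missed-self (fhat f) (d f)))

mainTheorem5 : (T : Theory) (k : ℕ) (φ : Tm (Sym T) (suc k)) →
    IsPred T φ →
    IsPMap T (μ φ) × MinSpec T φ (μ φ) ×
    ((f : RawPMap (Sym T) k) → IsPMap T f → MinSpec T φ f → _⊆̂_ T f (μ φ))
mainTheorem5 T k φ φ-pred = (φ-pred , μ-functional) , (μ-witness , μ-least) , μ-universal
  where open Minimisation T φ φ-pred
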